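{- Let $a,d,k$ be positive integers, where $k$ is odd and $\gcd(d,k)=1$. Define \[ S(a,d;k):=\sum_{i=1}^{k}(a+(i-1)d)^k=a^k+(a+d)^k+\cdots+(a+(k-1)d)^k. \] Then $S(a,d;k)\equiv 0\pmod{k^2}$. -}

module Defs where

open import Data.Nat using (ℕ; zero; suc; _+_; _*_; _^_)

sumAP : ℕ → ℕ → ℕ → ℕ → ℕ
sumAP a d k zero    = 0
sumAP a d k (suc m) = sumAP a d k m + (a + m * d) ^ k

S : ℕ → ℕ → ℕ → ℕ
S a d k = sumAP a d k k

-- Modulo k², a power y ^ k depends only on y modulo k: if y = x + k q then the binomial
-- expansion of (x + k q) ^ k is x ^ k plus multiples of k².  Since gcd (d, k) = 1 the terms
-- a, a + d, …, a + (k - 1) d run through all residues modulo k, so S(a,d;k) ≡ Σ_{r<k} r ^ k (mod k²).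
-- For odd k, r ^ k + (k - r) ^ k ≡ r ^ k + (- r) ^ k = 0 (mod k²), so twice Σ_{r≤k} r ^ k
-- is divisible by k², and since k² is odd so is the sum itself.
module Submission where

module PowerCongruences where
  open import Data.Nat as ℕ using (zero; suc)
  import Data.Nat.Properties as ℕ
  import Data.Nat.Divisibility as ℕ
  open import Data.Integer using (ℤ; +_; -_; _+_; _-_; _*_; _^_; _⊖_; 1ℤ)
  open import Data.Integer.Properties using (pos-+; pos-*; ⊖-≥; m-n≡m⊖n; neg-involutive)
  open import Data.Integer.Divisibility.Signed using (_∣_; divides; ∣⇒∣ᵤ)
  open import Data.Integer.Tactic.RingSolver using (solve-∀)
  open import Data.Empty using (⊥-elim)
  open import Data.Product using (∃; _,_)
  open import Function using (_∘_)
  open import Relation.Nullary using (¬_)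
  open import Relation.Binary.PropositionalEquality
  open ≡-Reasoning

  binomial-mod-square : ∀ x c q n → ∃ λ t →
    (x + c * q) ^ suc n ≡ x ^ suc n + + suc n * c * q * x ^ n + c * c * t
  binomial-mod-square x c q zero = + 0 , linear x c q
    where
    linear : ∀ x c q → (x + c * q) * 1ℤ ≡ x * 1ℤ + + 1 * c * q * 1ℤ + c * c * + 0
    linear = solve-∀
  binomial-mod-square x c q (suc n) with binomial-mod-square x c q n
  ... | t , eq = x * t + + suc n * q * q * x ^ n + c * q * t , (begin
    (x + c * q) * (x + c * q) ^ suc n
      ≡⟨ cong ((x + c * q) *_) eq ⟩
    (x + c * q) * (x * x ^ n + + suc n * c * q * x ^ n + c * c * t)
      ≡⟨ expand x (x ^ n) c q t (+ suc n) ⟩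
    x * (x * x ^ n) + (1ℤ + + suc n) * c * q * (x * x ^ n)
      + c * c * (x * t + + suc n * q * q * x ^ n + c * q * t) ∎)
    where
    expand : ∀ x X c q t N →
      (x + c * q) * (x * X + N * c * q * X + c * c * t)
        ≡ x * (x * X) + (1ℤ + N) * c * q * (x * X) + c * c * (x * t + N * q * q * X + c * q * t)
    expand = solve-∀

  -- With c equal to the exponent k, the linear term k · c q x ^ (k - 1) is a multiple of k² as well.
  k*k∣[x+k*q]^k-x^k : ∀ n x q → let k = + suc n in k * k ∣ (x + k * q) ^ suc n - x ^ suc n
  k*k∣[x+k*q]^k-x^k n x q with binomial-mod-square x (+ suc n) q n
  ... | t , eq = divides (q * x ^ n + t) (begin
    (x + k * q) ^ suc n - x ^ suc n                       ≡⟨ cong (_- x ^ suc n) eq ⟩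
    x ^ suc n + k * k * q * x ^ n + k * k * t - x ^ suc n ≡⟨ cancel (x ^ suc n) k q (x ^ n) t ⟩
    (q * x ^ n + t) * (k * k)                             ∎)
    where
    k = + suc n
    cancel : ∀ A k q X t → A + k * k * q * X + k * k * t - A ≡ (q * X + t) * (k * k)
    cancel = solve-∀

  pos-^ : ∀ m n → + (m ℕ.^ n) ≡ (+ m) ^ n
  pos-^ m zero    = refl
  pos-^ m (suc n) = trans (pos-* m (m ℕ.^ n)) (cong (+ m *_) (pos-^ m n))

  ^-neg-odd : ∀ x {n} → ¬ 2 ℕ.∣ n → (- x) ^ n ≡ - (x ^ n)
  ^-neg-odd x {zero}        2∤0 = ⊥-elim (2∤0 (ℕ._∣0 2))
  ^-neg-odd x {suc zero}    _   = neg-linear x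
    where
    neg-linear : ∀ x → (- x) * 1ℤ ≡ - (x * 1ℤ)
    neg-linear = solve-∀
  ^-neg-odd x {suc (suc n)} 2∤n+2 = begin
    (- x) * ((- x) * (- x) ^ n) ≡⟨ cong (λ z → (- x) * ((- x) * z)) (^-neg-odd x 2∤n) ⟩
    (- x) * ((- x) * - (x ^ n)) ≡⟨ neg-cubic x (x ^ n) ⟩
    - (x * (x * x ^ n))         ∎
    where
    2∤n = 2∤n+2 ∘ ℕ.∣m∣n⇒∣m+n (ℕ.∣-refl {2})
    neg-cubic : ∀ x X → (- x) * ((- x) * - X) ≡ - (x * (x * X))
    neg-cubic = solve-∀

  k∣y∸x⇒k*k∣y^k∸x^k : ∀ {x y} n → x ℕ.≤ y → suc n ℕ.∣ y ℕ.∸ x →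
    suc n ℕ.* suc n ℕ.∣ y ℕ.^ suc n ℕ.∸ x ℕ.^ suc n
  k∣y∸x⇒k*k∣y^k∸x^k {x} {y} n x≤y (ℕ.divides q y∸x≡qk) =
    ∣⇒∣ᵤ (subst (+ k * + k ∣_) cast (k*k∣[x+k*q]^k-x^k n (+ x) (+ q)))
    where
    k = suc n
    x+kq≡y : x ℕ.+ k ℕ.* q ≡ y
    x+kq≡y = trans (cong (x ℕ.+_) (trans (ℕ.*-comm k q) (sym y∸x≡qk))) (ℕ.m+[n∸m]≡n x≤y)
    cast : (+ x + + k * + q) ^ k - (+ x) ^ k ≡ + (y ℕ.^ k ℕ.∸ x ℕ.^ k)
    cast = begin
      (+ x + + k * + q) ^ k - (+ x) ^ k   ≡⟨ cong (λ z → (+ x + z) ^ k - (+ x) ^ k) (pos-* k q) ⟨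
      (+ (x ℕ.+ k ℕ.* q)) ^ k - (+ x) ^ k ≡⟨ cong (λ z → (+ z) ^ k - (+ x) ^ k) x+kq≡y ⟩
      (+ y) ^ k - (+ x) ^ k               ≡⟨ cong₂ _-_ (pos-^ y k) (pos-^ x k) ⟨
      + (y ℕ.^ k) - + (x ℕ.^ k)           ≡⟨ m-n≡m⊖n (y ℕ.^ k) (x ℕ.^ k) ⟩
      y ℕ.^ k ⊖ x ℕ.^ k                   ≡⟨ ⊖-≥ (ℕ.^-monoˡ-≤ k x≤y) ⟩
      + (y ℕ.^ k ℕ.∸ x ℕ.^ k)             ∎

  k*k∣r^k+s^k : ∀ {r s k} → ¬ 2 ℕ.∣ k → r ℕ.+ s ≡ k → k ℕ.* k ℕ.∣ r ℕ.^ k ℕ.+ s ℕ.^ k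
  k*k∣r^k+s^k {k = zero}          2∤0 _ = ⊥-elim (2∤0 (ℕ._∣0 2))
  k*k∣r^k+s^k {r} {s} {k = suc n} 2∤k r+s≡k =
    ∣⇒∣ᵤ (subst (+ k * + k ∣_) cast (k*k∣[x+k*q]^k-x^k n (- + s) 1ℤ))
    where
    k = suc n
    -s+k≡r : - + s + + k * 1ℤ ≡ + r
    -s+k≡r = begin
      - + s + + k * 1ℤ         ≡⟨ cong (λ z → - + s + z * 1ℤ) (trans (cong +_ (sym r+s≡k)) (pos-+ r s)) ⟩
      - + s + (+ r + + s) * 1ℤ ≡⟨ cancel (+ r) (+ s) ⟩
      + r                      ∎
      where
      cancel : ∀ r s → - s + (r + s) * 1ℤ ≡ r
      cancel = solve-∀
    cast : (- + s + + k * 1ℤ) ^ k - (- + s) ^ k ≡ + (r ℕ.^ k ℕ.+ s ℕ.^ k)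
    cast = begin
      (- + s + + k * 1ℤ) ^ k - (- + s) ^ k ≡⟨ cong₂ (λ u v → u ^ k - v) -s+k≡r (^-neg-odd (+ s) 2∤k) ⟩
      (+ r) ^ k + - - (+ s) ^ k            ≡⟨ cong (λ z → (+ r) ^ k + z) (neg-involutive ((+ s) ^ k)) ⟩
      (+ r) ^ k + (+ s) ^ k                ≡⟨ cong₂ _+_ (pos-^ r k) (pos-^ s k) ⟨
      + (r ℕ.^ k) + + (s ℕ.^ k)            ≡⟨ pos-+ (r ℕ.^ k) (s ℕ.^ k) ⟨
      + (r ℕ.^ k ℕ.+ s ℕ.^ k)              ∎

open PowerCongruences using (k∣y∸x⇒k*k∣y^k∸x^k; k*k∣r^k+s^k)

open import Defs
open import Data.Nat using (ℕ; zero; suc; _+_; _*_; _∸_; _^_; _>_; _≤_; _<_; z≤n; s≤s; NonZero)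
open import Data.Nat.Properties
open import Data.Nat.Divisibility
open import Data.Nat.DivMod using (_%_; _/_; _mod_; m≡m%n+[m/n]*n; m%n%n≡m%n; m%n≤m; m%n<n)
open import Data.Nat.GCD using (gcd)
open import Data.Nat.Coprimality using (Coprime; gcd≡1⇒coprime; coprime-divisor)
  renaming (sym to coprime-sym)
open import Data.Nat.Primality using (euclidsLemma; prime[2])
open import Data.Fin as Fin using (Fin; toℕ; opposite)
open import Data.Fin.Properties
  using ( toℕ-injective; toℕ-fromℕ<; toℕ-fromℕ; toℕ-inject₁; toℕ≤pred[n]; toℕ<n; opposite-prop
        ; any?; punchOut-injective; <⇒notInjective)
  renaming (_≟_ to _≟ᶠ_)
import Data.Fin.Permutation as Permutation
open import Algebra.Properties.CommutativeMonoid.Sum +-0-commutativeMonoid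
  using (sum; sum-syntax; sum-cong-≗; sum-init-last; sum-permute; ∑-distrib-+)
open import Data.Product using (∃; _,_; proj₁; proj₂)
open import Data.Sum using ([_,_]′)
open import Data.Empty using (⊥-elim)
open import Function using (_∘_; Injective)
open import Relation.Nullary using (¬_; yes; no)
open import Relation.Binary.PropositionalEquality

∣-sum : ∀ {d n} (f : Fin n → ℕ) → (∀ i → d ∣ f i) → d ∣ sum f
∣-sum {n = zero}  f d∣f = _ ∣0
∣-sum {n = suc n} f d∣f = ∣m∣n⇒∣m+n (d∣f Fin.zero) (∣-sum (f ∘ Fin.suc) (d∣f ∘ Fin.suc))

sum-init-last-toℕ : ∀ n (f : ℕ → ℕ) → ∑[ i < suc n ] f (toℕ i) ≡ ∑[ i < n ] f (toℕ i) + f n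
sum-init-last-toℕ n f = begin
  ∑[ i < suc n ] f (toℕ i)                                   ≡⟨ sum-init-last (f ∘ toℕ) ⟩
  ∑[ i < n ] f (toℕ (Fin.inject₁ i)) + f (toℕ (Fin.fromℕ n)) ≡⟨ cong₂ _+_ (sum-cong-≗ {n} (cong f ∘ toℕ-inject₁))
                                                                           (cong f (toℕ-fromℕ n)) ⟩
  ∑[ i < n ] f (toℕ i) + f n                                 ∎
  where open ≡-Reasoning

sumAP≡∑ : ∀ a d k n → sumAP a d k n ≡ ∑[ i < n ] ((a + toℕ i * d) ^ k)
sumAP≡∑ a d k zero    = refl
sumAP≡∑ a d k (suc n) = trans (cong (_+ (a + n * d) ^ k) (sumAP≡∑ a d k n))
                              (sym (sum-init-last-toℕ n (λ i → (a + i * d) ^ k)))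

injective⇒surjective : ∀ {n} {g : Fin n → Fin n} → Injective _≡_ _≡_ g → ∀ y → ∃ λ x → g x ≡ y
injective⇒surjective {suc n} {g} g-inj y with any? (λ x → g x ≟ᶠ y)
... | yes gx≡y = gx≡y
... | no  g≢y  = ⊥-elim (<⇒notInjective (n<1+n n) h-inj)
  where
  h : Fin (suc n) → Fin n
  h x = Fin.punchOut {i = y} {j = g x} (λ y≡gx → g≢y (x , sym y≡gx))
  h-inj : Injective _≡_ _≡_ h
  h-inj {x} {x′} = g-inj ∘ punchOut-injective {i = y} {j = g x} {k = g x′} _ _

sum-∘-injective : ∀ {n} (f : Fin n → ℕ) {g : Fin n → Fin n} → Injective _≡_ _≡_ g → sum (f ∘ g) ≡ sum f
sum-∘-injective f {g} g-inj = sym (sum-permute f π)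
  where
  surj = injective⇒surjective g-inj
  π : Permutation.Permutation′ _
  π = Permutation.permutation g (proj₁ ∘ surj) (proj₂ ∘ surj) (g-inj ∘ proj₂ ∘ surj ∘ g)

%≡%⇒∣∸ : ∀ m n {k} .{{_ : NonZero k}} → m % k ≡ n % k → k ∣ m ∸ n
%≡%⇒∣∸ m n {k} m%k≡n%k = divides (m / k ∸ n / k) (begin
  m ∸ n                                     ≡⟨ cong₂ _∸_ (m≡m%n+[m/n]*n m k) (m≡m%n+[m/n]*n n k) ⟩
  (m % k + m / k * k) ∸ (n % k + n / k * k) ≡⟨ cong (λ r → (m % k + m / k * k) ∸ (r + n / k * k)) m%k≡n%k ⟨
  (m % k + m / k * k) ∸ (m % k + n / k * k) ≡⟨ [m+n]∸[m+o]≡n∸o (m % k) _ _ ⟩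
  m / k * k ∸ n / k * k                     ≡⟨ *-distribʳ-∸ k (m / k) (n / k) ⟨
  (m / k ∸ n / k) * k                       ∎)
  where open ≡-Reasoning

∣∧<⇒≡0 : ∀ {k e} → k ∣ e → e < k → e ≡ 0
∣∧<⇒≡0 {e = zero}  _   _   = refl
∣∧<⇒≡0 {e = suc _} k∣e e<k = ⊥-elim (>⇒∤ e<k k∣e)

module _ {k d} .{{_ : NonZero k}} (k⊥d : Coprime k d) (a : ℕ) where

  progression-%-injective : ∀ {i j} → i < k → j < k → (a + i * d) % k ≡ (a + j * d) % k → i ≡ j
  progression-%-injective {i} {j} i<k j<k eq =
    [ (λ i≤j → ordered i≤j j<k eq) , (λ j≤i → sym (ordered j≤i i<k (sym eq))) ]′ (≤-total i j)
    where
    ordered : ∀ {i j} → i ≤ j → j < k → (a + i * d) % k ≡ (a + j * d) % k → i ≡ j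
    ordered {i} {j} i≤j j<k eq = ≤-antisym i≤j (m∸n≡0⇒m≤n (∣∧<⇒≡0 k∣j∸i (≤-<-trans (m∸n≤m j i) j<k)))
      where
      open ≡-Reasoning
      k∣j∸i : k ∣ j ∸ i
      k∣j∸i = coprime-divisor k⊥d (subst (k ∣_) (begin
        (a + j * d) ∸ (a + i * d) ≡⟨ [m+n]∸[m+o]≡n∸o a _ _ ⟩
        j * d ∸ i * d             ≡⟨ *-distribʳ-∸ d j i ⟨
        (j ∸ i) * d               ≡⟨ *-comm (j ∸ i) d ⟩
        d * (j ∸ i)               ∎) (%≡%⇒∣∸ _ _ (sym eq)))

  progression-mod-injective : Injective _≡_ _≡_ (λ (i : Fin k) → (a + toℕ i * d) mod k)
  progression-mod-injective {i} {j} eq = toℕ-injective (progression-%-injective (toℕ<n i) (toℕ<n j)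
    (trans (sym (toℕ-fromℕ< _)) (trans (cong toℕ eq) (toℕ-fromℕ< _))))

¬2∣⇒coprime-2 : ∀ {m} → ¬ 2 ∣ m → Coprime m 2
¬2∣⇒coprime-2 2∤m {zero}              (_ , 0∣2) = ⊥-elim (0≢2 (sym (0∣⇒≡0 0∣2)))
  where
  0≢2 : 0 ≢ 2
  0≢2 ()
¬2∣⇒coprime-2 2∤m {1}                 _         = refl
¬2∣⇒coprime-2 2∤m {2}                 (2∣m , _) = ⊥-elim (2∤m 2∣m)
¬2∣⇒coprime-2 2∤m {suc (suc (suc _))} (_ , i∣2) = ⊥-elim (>⇒∤ (s≤s (s≤s (s≤s z≤n))) i∣2)

k*k∣k^k : ∀ n → suc n * suc n ∣ suc n ^ suc n
k*k∣k^k zero    = 1∣ 1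
k*k∣k^k (suc p) = subst (k * k ∣_) (*-assoc k k (k ^ p)) (m∣m*n (k ^ p))
  where k = suc (suc p)

k*k∣∑r^k : ∀ k → ¬ 2 ∣ k → k * k ∣ ∑[ r < k ] (toℕ r ^ k)
k*k∣∑r^k zero    2∤0 = ⊥-elim (2∤0 (2 ∣0))
k*k∣∑r^k (suc n) 2∤k = ∣m+n∣m⇒∣n (subst (k * k ∣_) T≡k^k+∑ k*k∣T) (k*k∣k^k n)
  where
  open ≡-Reasoning
  k = suc n
  T = ∑[ r < suc k ] (toℕ r ^ k)
  T≡k^k+∑ : T ≡ k ^ k + ∑[ r < k ] (toℕ r ^ k)
  T≡k^k+∑ = trans (sum-init-last-toℕ k (_^ k)) (+-comm _ (k ^ k))
  T+T≡∑pairs : T + T ≡ ∑[ r < suc k ] (toℕ r ^ k + (k ∸ toℕ r) ^ k)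
  T+T≡∑pairs = begin
    T + T                                         ≡⟨ cong (T +_) (sum-permute (λ r → toℕ r ^ k) Permutation.reverse) ⟩
    T + ∑[ r < suc k ] (toℕ (opposite r) ^ k)     ≡⟨ cong (T +_) (sum-cong-≗ {suc k} (cong (_^ k) ∘ opposite-prop)) ⟩
    T + ∑[ r < suc k ] ((k ∸ toℕ r) ^ k)          ≡⟨ ∑-distrib-+ {suc k} (λ r → toℕ r ^ k) (λ r → (k ∸ toℕ r) ^ k) ⟨
    ∑[ r < suc k ] (toℕ r ^ k + (k ∸ toℕ r) ^ k) ∎
  k*k∣T+T : k * k ∣ T + T
  k*k∣T+T = subst (k * k ∣_) (sym T+T≡∑pairs)
    (∣-sum (λ (r : Fin (suc k)) → toℕ r ^ k + (k ∸ toℕ r) ^ k)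
           (λ r → k*k∣r^k+s^k {toℕ r} 2∤k (m+[n∸m]≡n (toℕ≤pred[n] r))))
  k*k∣T : k * k ∣ T
  k*k∣T = coprime-divisor (¬2∣⇒coprime-2 (λ 2∣k*k → [ 2∤k , 2∤k ]′ (euclidsLemma k k prime[2] 2∣k*k)))
    (subst (k * k ∣_) (cong (T +_) (sym (+-identityʳ T))) k*k∣T+T)

k*k∣y^k∸[y%k]^k : ∀ n y → suc n * suc n ∣ y ^ suc n ∸ (y % suc n) ^ suc n
k*k∣y^k∸[y%k]^k n y =
  k∣y∸x⇒k*k∣y^k∸x^k n (m%n≤m y (suc n)) (%≡%⇒∣∸ y (y % suc n) (sym (m%n%n≡m%n y (suc n))))

theorem4p2 : ∀ (a d k : ℕ) → a > 0 → d > 0 → k > 0 → ¬ (2 ∣ k) → gcd d k ≡ 1 →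
    k ^ 2 ∣ S a d k
theorem4p2 a d (suc n) _ _ _ 2∤k gcd≡1 =
  subst (_∣ S a d k) (cong (k *_) (sym (*-identityʳ k))) (subst (k * k ∣_) (sym S≡) k*k∣S)
  where
  open ≡-Reasoning
  k = suc n
  y x : Fin k → ℕ
  y i = a + toℕ i * d
  x i = y i % k
  S≡ : S a d k ≡ ∑[ i < k ] (x i ^ k) + ∑[ i < k ] (y i ^ k ∸ x i ^ k)
  S≡ = begin
    S a d k                                               ≡⟨ sumAP≡∑ a d k k ⟩
    ∑[ i < k ] (y i ^ k)                                  ≡⟨ sum-cong-≗ {k} (λ i → m+[n∸m]≡n (^-monoˡ-≤ k (m%n≤m (y i) k))) ⟨
    ∑[ i < k ] (x i ^ k + (y i ^ k ∸ x i ^ k))            ≡⟨ ∑-distrib-+ {k} (λ i → x i ^ k) (λ i → y i ^ k ∸ x i ^ k) ⟩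
    ∑[ i < k ] (x i ^ k) + ∑[ i < k ] (y i ^ k ∸ x i ^ k) ∎
  ∑x^k≡∑r^k : ∑[ i < k ] (x i ^ k) ≡ ∑[ r < k ] (toℕ r ^ k)
  ∑x^k≡∑r^k = trans (sum-cong-≗ {k} (λ i → cong (_^ k) (sym (toℕ-fromℕ< (m%n<n (y i) k)))))
    (sum-∘-injective (λ r → toℕ r ^ k) (progression-mod-injective (coprime-sym (gcd≡1⇒coprime gcd≡1)) a))
  k*k∣S : k * k ∣ ∑[ i < k ] (x i ^ k) + ∑[ i < k ] (y i ^ k ∸ x i ^ k)
  k*k∣S = ∣m∣n⇒∣m+n (subst (k * k ∣_) (sym ∑x^k≡∑r^k) (k*k∣∑r^k k 2∤k))
                    (∣-sum (λ i → y i ^ k ∸ x i ^ k) (λ i → k*k∣y^k∸[y%k]^k n (y i)))
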